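{- Let $H=(V,E)$ be a hypergraph, $\bar x\in\mathbb{R}^E_+$ and $\beta\in\mathbb{R}$. Let $\Phi=\{S_1,\dots,S_p\}$ be a partition of $V$ minimizing $\bar x(\delta(\mathscr{P}))-\beta(|\mathscr{P}|-1)$ over all partitions $\mathscr{P}$ of $V$. Let $1\le i\le p$ and let $\{T_1,\dots,T_q\}$ be a partition of $S_i$. Then $\bar x(\delta(T_1,\dots,T_q))-\beta(q-1)\ge 0$.
   Context: A hypergraph $H=(V,E)$ consists of a finite node set $V$ and a finite family $E$ of nonempty subsets of $V$. For a family $\{V_1,\dots,V_k\}$ of pairwise disjoint nonempty subsets of $V$, $\delta(V_1,\dots,V_k)$ denotes the set of hyperedges of $E$ that are contained in $\bigcup_i V_i$ and intersect at least two of the sets $V_i$. For $x\in\mathbb{R}^E$ and $S\subseteq E$, $x(S)=\sum_{e\in S}x(e)$. -}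

module Defs where

open import Level using (Level; suc; _⊔_)
open import Data.Nat using (ℕ)
open import Data.Fin using (Fin; _≟_)
open import Data.Fin.Subset using (Subset; _∈_; _∩_; Nonempty)
open import Data.Fin.Subset.Properties using (_∈?_; nonempty?)
open import Data.Fin.Properties using (any?; all?)
open import Data.Product using (∃; _×_; _,_)
open import Data.Empty using (⊥)
open import Relation.Binary.PropositionalEquality using (_≡_; _≢_)
open import Relation.Nullary using (¬_; Dec; yes; no)
open import Relation.Nullary.Decidable using (_×-dec_; _→-dec_; ¬?)
open import Relation.Binary.Structures using (IsTotalOrder)
open import Function.Bundles using (_⇔_)
open import Algebra.Bundles using (CommutativeRing)
import Algebra.Properties.Monoid.Sum as MonoidSum
import Algebra.Definitions.RawMonoid as RawMonoidDefs

-- Totally ordered commutative rings (ℝ is an instance).  The statement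
-- is stated for every such ring, in particular for the reals.

record OrderedCommutativeRing (c ℓ₁ ℓ₂ : Level) : Set (suc (c ⊔ ℓ₁ ⊔ ℓ₂)) where
  field
    commutativeRing : CommutativeRing c ℓ₁
  open CommutativeRing commutativeRing public
  infix 4 _≤_
  field
    _≤_          : Carrier → Carrier → Set ℓ₂
    isTotalOrder : IsTotalOrder _≈_ _≤_
    +-mono-≤     : ∀ {x y} z → x ≤ y → x + z ≤ y + z
    *-nonneg     : ∀ {x y} → 0# ≤ x → 0# ≤ y → 0# ≤ x * y

-- Hypergraphs with node set V = Fin n and hyperedge family E indexed by
-- Fin m (a family: repeated hyperedges are allowed); hyperedges nonempty.

record Hypergraph (n m : ℕ) : Set where
  field
    edge     : Fin m → Subset n
    nonempty : ∀ e → Nonempty (edge e)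

Family : ℕ → ℕ → Set
Family n k = Fin k → Subset n

_∈⋃_ : ∀ {n k} → Fin n → Family n k → Set
v ∈⋃ P = ∃ λ i → v ∈ P i

PairwiseDisjoint : ∀ {n k} → Family n k → Set
PairwiseDisjoint P = ∀ i j → i ≢ j → ∀ v → v ∈ P i → v ∈ P j → ⊥

IsPartitionOf : ∀ {n k} → Family n k → Subset n → Set
IsPartitionOf P S =
  PairwiseDisjoint P × (∀ i → Nonempty (P i)) × (∀ v → (v ∈ S) ⇔ (v ∈⋃ P))

Meets : ∀ {n} → Subset n → Subset n → Set
Meets A B = Nonempty (A ∩ B)

Inδ : ∀ {n m k} → Hypergraph n m → Family n k → Fin m → Set
Inδ H P e =
  (∀ v → v ∈ Hypergraph.edge H e → v ∈⋃ P) ×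
  ∃ λ i → ∃ λ j → i ≢ j × Meets (Hypergraph.edge H e) (P i) × Meets (Hypergraph.edge H e) (P j)

inδ? : ∀ {n m k} (H : Hypergraph n m) (P : Family n k) (e : Fin m) → Dec (Inδ H P e)
inδ? H P e =
  all? (λ v → (v ∈? Hypergraph.edge H e) →-dec any? (λ i → v ∈? P i)) ×-dec
  any? (λ i → any? (λ j → ¬? (i ≟ j) ×-dec
    (nonempty? (Hypergraph.edge H e ∩ P i) ×-dec nonempty? (Hypergraph.edge H e ∩ P j))))

module _ {c ℓ₁ ℓ₂} (R : OrderedCommutativeRing c ℓ₁ ℓ₂) where
  open OrderedCommutativeRing R
  open MonoidSum +-monoid using (sum)
  open RawMonoidDefs +-rawMonoid using () renaming (_×_ to _·ℕ_)

  xδ : ∀ {n m k} → Hypergraph n m → (Fin m → Carrier) → Family n k → Carrier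
  xδ H x P = sum (λ e → indicator (inδ? H P e) (x e))
    where
      indicator : ∀ {a} {A : Set a} → Dec A → Carrier → Carrier
      indicator (yes _) y = y
      indicator (no _)  _ = 0#

  -- x(δ(P)) − β(|P| − 1), where |P| = k;  β(k − 1) written as (k ·ℕ β) − β, k ·ℕ β = β+…+β (k times).
  objective : ∀ {n m k} → Hypergraph n m → (Fin m → Carrier) → Carrier → Family n k → Carrier
  objective {k = k} H x β P = xδ H x P - ((k ·ℕ β) - β)

{-# OPTIONS --safe #-}
-- Replacing the block S_i of Φ by T_1, …, T_q yields a partition Q of V with
-- δ(Q) = δ(Φ) ⊎ δ(T): an edge inside S_i meets only S_i among the blocks of Φ,
-- and an edge crossing Q either crosses Φ or lies inside S_i and crosses T.
-- Since also |Q| − 1 = (|Φ| − 1) + (q − 1), the objective of Q is the sum of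
-- the objectives of Φ and T, and minimality of Φ forces the latter to be ≥ 0.
module Submission where

open import Defs
open import Level using (Level)
open import Data.Nat as ℕ using (ℕ; suc)
open import Data.Fin using (Fin; zero; _↑ˡ_; _↑ʳ_; splitAt; punchIn; punchOut; _≟_)
open import Data.Fin.Properties using (any?; splitAt-↑ˡ; splitAt-↑ʳ; splitAt⁻¹-↑ˡ; splitAt⁻¹-↑ʳ;
  ↑ˡ-injective; punchIn-injective; punchInᵢ≢i; punchIn-punchOut)
open import Data.Fin.Subset using (Subset; _∈_; _⊆_; Nonempty; ⊤)
open import Data.Fin.Subset.Properties using (_∈?_; x∈p∩q⁺; x∈p∩q⁻; ⊆-reflexive)
open import Data.Product using (∃; ∃₂; _×_; _,_; proj₁; proj₂; map₂)
open import Data.Sum using (_⊎_; inj₁; inj₂; [_,_]′)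
open import Data.Empty using (⊥; ⊥-elim)
open import Function using (_∘_)
open import Function.Bundles using (_⇔_; mk⇔; Equivalence)
open import Function.Definitions using (Injective)
open import Relation.Nullary using (¬_; yes; no)
open import Relation.Nullary.Decidable using (_×-dec_; ¬?; decidable-stable)
open import Relation.Binary.PropositionalEquality as ≡ using (_≡_; _≢_)
open import Relation.Binary.Structures using (IsTotalOrder)

private
  variable
    n k l : ℕ

_⊆⋃_ : Subset n → Family n k → Set
E ⊆⋃ P = ∀ v → v ∈ E → v ∈⋃ P

MeetsTwo : Subset n → Family n k → Set
MeetsTwo E P = ∃₂ λ a b → a ≢ b × Meets E (P a) × Meets E (P b)

-- E ∈ δ(P); Inδ H P e unfolds to Crosses (Hypergraph.edge H e) P.
Crosses : Subset n → Family n k → Set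
Crosses E P = E ⊆⋃ P × MeetsTwo E P

meets⁺ : ∀ {E A : Subset n} {v} → v ∈ E → v ∈ A → Meets E A
meets⁺ v∈E v∈A = _ , x∈p∩q⁺ (v∈E , v∈A)

meets⁻ : ∀ {E A : Subset n} → Meets E A → ∃ λ v → v ∈ E × v ∈ A
meets⁻ {E = E} {A} (v , v∈E∩A) = v , x∈p∩q⁻ E A v∈E∩A

meets-mono : ∀ {E A B : Subset n} → A ⊆ B → Meets E A → Meets E B
meets-mono A⊆B m with meets⁻ m
... | v , v∈E , v∈A = meets⁺ v∈E (A⊆B v∈A)

meetsTwo⁺ : ∀ {E : Subset n} {P : Family n k} {u w a b} →
  u ∈ E → w ∈ E → u ∈ P a → w ∈ P b → a ≢ b → MeetsTwo E P
meetsTwo⁺ u∈E w∈E u∈Pa w∈Pb a≢b = _ , _ , a≢b , meets⁺ u∈E u∈Pa , meets⁺ w∈E w∈Pb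

⊆⋃-or-escapes : (E : Subset n) (P : Family n k) → E ⊆⋃ P ⊎ ∃ λ v → v ∈ E × ¬ v ∈⋃ P
⊆⋃-or-escapes E P with any? (λ v → v ∈? E ×-dec ¬? (any? λ a → v ∈? P a))
... | yes (v , v∈E , v∉⋃P) = inj₂ (v , v∈E , v∉⋃P)
... | no no-escape = inj₁ λ v v∈E →
  decidable-stable (any? λ a → v ∈? P a) (λ v∉⋃P → no-escape (v , v∈E , v∉⋃P))

module _ {P : Family n k} {S : Subset n} (P-part : IsPartitionOf P S) where

  partition-disjoint : PairwiseDisjoint P
  partition-disjoint = proj₁ P-part

  partition-nonempty : ∀ a → Nonempty (P a)
  partition-nonempty = proj₁ (proj₂ P-part)

  partition-⊆ : ∀ a → P a ⊆ S
  partition-⊆ a v∈Pa = Equivalence.from (proj₂ (proj₂ P-part) _) (a , v∈Pa)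

  partition-⊇ : ∀ {v} → v ∈ S → v ∈⋃ P
  partition-⊇ v∈S = Equivalence.to (proj₂ (proj₂ P-part) _) v∈S

block-unique : ∀ {P : Family n k} → PairwiseDisjoint P → ∀ {a b v} → v ∈ P a → v ∈ P b → a ≡ b
block-unique disjoint {a} {b} {v} v∈Pa v∈Pb with a ≟ b
... | yes a≡b = a≡b
... | no a≢b = ⊥-elim (disjoint a b a≢b v v∈Pa v∈Pb)

¬meetsTwo-⊆block : ∀ {P : Family n k} {E a} → PairwiseDisjoint P → E ⊆ P a → ¬ MeetsTwo E P
¬meetsTwo-⊆block {P = P} {E} {a} disjoint E⊆Pa (b , c , b≢c , mb , mc) =
  b≢c (≡.trans (towards-a mb) (≡.sym (towards-a mc)))
  where
  towards-a : ∀ {d} → Meets E (P d) → d ≡ a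
  towards-a m with meets⁻ m
  ... | v , v∈E , v∈Pd = block-unique disjoint v∈Pd (E⊆Pa v∈E)

meetsTwo-subfamily : ∀ {E} {T : Family n k} {Q : Family n l} (f : Fin k → Fin l) →
  Injective _≡_ _≡_ f → (∀ t → T t ⊆ Q (f t)) → MeetsTwo E T → MeetsTwo E Q
meetsTwo-subfamily f f-inj T⊆Qf (a , b , a≢b , ma , mb) =
  f a , f b , a≢b ∘ f-inj , meets-mono (T⊆Qf a) ma , meets-mono (T⊆Qf b) mb

meetsTwo-refinement : ∀ {E} {P : Family n k} {Q : Family n l} → PairwiseDisjoint P →
  (∀ j → ∃ λ a → Q j ⊆ P a) → (∀ {v} → v ∈⋃ P → v ∈⋃ Q) → MeetsTwo E P → MeetsTwo E Q
meetsTwo-refinement {P = P} {Q} disjoint refines ⋃P⊆⋃Q (a , b , a≢b , ma , mb)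
  with meets⁻ ma | meets⁻ mb
... | u , u∈E , u∈Pa | w , w∈E , w∈Pb with ⋃P⊆⋃Q (a , u∈Pa) | ⋃P⊆⋃Q (b , w∈Pb)
...   | j₁ , u∈Qj₁ | j₂ , w∈Qj₂ = meetsTwo⁺ u∈E w∈E u∈Qj₁ w∈Qj₂ (separated u∈Qj₁ w∈Qj₂)
  where
  separated : ∀ {j₁ j₂} → u ∈ Q j₁ → w ∈ Q j₂ → j₁ ≢ j₂
  separated {j₁} u∈Qj₁ w∈Qj₁ ≡.refl with refines j₁
  ... | d , Qj⊆Pd = a≢b (≡.trans (block-unique disjoint u∈Pa (Qj⊆Pd u∈Qj₁))
                                 (block-unique disjoint (Qj⊆Pd w∈Qj₁) w∈Pb))

data SplitView (q p : ℕ) : Fin (q ℕ.+ p) → Set where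
  inner : (t : Fin q) → SplitView q p (t ↑ˡ p)
  outer : (b : Fin p) → SplitView q p (q ↑ʳ b)

splitView : ∀ q {p} (j : Fin (q ℕ.+ p)) → SplitView q p j
splitView q j with splitAt q j in eq
... | inj₁ t = ≡.subst (SplitView q _) (splitAt⁻¹-↑ˡ eq) (inner t)
... | inj₂ b = ≡.subst (SplitView q _) (splitAt⁻¹-↑ʳ eq) (outer b)

-- Φ with its block i replaced by the blocks of T (indexed first).
refineAt : ∀ {p q} → Family n (suc p) → Fin (suc p) → Family n q → Family n (q ℕ.+ p)
refineAt {q = q} Φ i T = [ T , Φ ∘ punchIn i ]′ ∘ splitAt q

module _ {p q} (Φ : Family n (suc p)) (i : Fin (suc p)) (T : Family n q) where

  refineAt-inner : ∀ t → refineAt Φ i T (t ↑ˡ p) ≡ T t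
  refineAt-inner t = ≡.cong [ T , Φ ∘ punchIn i ]′ (splitAt-↑ˡ q t p)

  refineAt-outer : ∀ b → refineAt Φ i T (q ↑ʳ b) ≡ Φ (punchIn i b)
  refineAt-outer b = ≡.cong [ T , Φ ∘ punchIn i ]′ (splitAt-↑ʳ q p b)

module Refinement {n p q} {S : Subset n} {Φ : Family n (suc p)} {i : Fin (suc p)}
  {T : Family n q} (Φ-part : IsPartitionOf Φ S) (T-part : IsPartitionOf T (Φ i)) where

  Q : Family n (q ℕ.+ p)
  Q = refineAt Φ i T

  private
    Φ-disjoint = partition-disjoint Φ-part

    inner⊆ : ∀ t → Q (t ↑ˡ p) ⊆ T t
    inner⊆ t = ⊆-reflexive (refineAt-inner Φ i T t)

    ⊆inner : ∀ t → T t ⊆ Q (t ↑ˡ p)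
    ⊆inner t = ⊆-reflexive (≡.sym (refineAt-inner Φ i T t))

    outer⊆ : ∀ b → Q (q ↑ʳ b) ⊆ Φ (punchIn i b)
    outer⊆ b = ⊆-reflexive (refineAt-outer Φ i T b)

    ⊆outer : ∀ b → Φ (punchIn i b) ⊆ Q (q ↑ʳ b)
    ⊆outer b = ⊆-reflexive (≡.sym (refineAt-outer Φ i T b))

    i≢punchIn : ∀ b → i ≢ punchIn i b
    i≢punchIn b = punchInᵢ≢i i b ∘ ≡.sym

    T⊆Φi : ∀ t → T t ⊆ Φ i
    T⊆Φi = partition-⊆ T-part

  refineAt-refines : ∀ j → ∃ λ a → Q j ⊆ Φ a
  refineAt-refines j with splitView q j
  ... | inner t = i , T⊆Φi t ∘ inner⊆ t
  ... | outer b = punchIn i b , outer⊆ b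

  ⋃refineAt⊆⋃ : ∀ {v} → v ∈⋃ Q → v ∈⋃ Φ
  ⋃refineAt⊆⋃ (j , v∈Qj) with refineAt-refines j
  ... | a , Qj⊆Φa = a , Qj⊆Φa v∈Qj

  ⋃⊆⋃refineAt : ∀ {v} → v ∈⋃ Φ → v ∈⋃ Q
  ⋃⊆⋃refineAt {v} (a , v∈Φa) with i ≟ a
  ... | yes ≡.refl with partition-⊇ T-part v∈Φa
  ...   | t , v∈Tt = t ↑ˡ p , ⊆inner t v∈Tt
  ⋃⊆⋃refineAt {v} (a , v∈Φa) | no i≢a =
    q ↑ʳ punchOut i≢a , ⊆outer _ (≡.subst (λ c → v ∈ Φ c) (≡.sym (punchIn-punchOut i≢a)) v∈Φa)

  refineAt-disjoint : PairwiseDisjoint Q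
  refineAt-disjoint j₁ j₂ j₁≢j₂ v v∈Qj₁ v∈Qj₂ with splitView q j₁ | splitView q j₂
  ... | inner t₁ | inner t₂ = partition-disjoint T-part t₁ t₂ (j₁≢j₂ ∘ ≡.cong (_↑ˡ p)) v
        (inner⊆ t₁ v∈Qj₁) (inner⊆ t₂ v∈Qj₂)
  ... | inner t | outer b = Φ-disjoint i (punchIn i b) (i≢punchIn b) v
        (T⊆Φi t (inner⊆ t v∈Qj₁)) (outer⊆ b v∈Qj₂)
  ... | outer b | inner t = Φ-disjoint i (punchIn i b) (i≢punchIn b) v
        (T⊆Φi t (inner⊆ t v∈Qj₂)) (outer⊆ b v∈Qj₁)
  ... | outer b₁ | outer b₂ = Φ-disjoint (punchIn i b₁) (punchIn i b₂)
        (j₁≢j₂ ∘ ≡.cong (q ↑ʳ_) ∘ punchIn-injective i b₁ b₂) v (outer⊆ b₁ v∈Qj₁) (outer⊆ b₂ v∈Qj₂)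

  refineAt-nonempty : ∀ j → Nonempty (Q j)
  refineAt-nonempty j with splitView q j
  ... | inner t = map₂ (⊆inner t) (partition-nonempty T-part t)
  ... | outer b = map₂ (⊆outer b) (partition-nonempty Φ-part (punchIn i b))

  refineAt-partition : IsPartitionOf Q S
  refineAt-partition = refineAt-disjoint , refineAt-nonempty , λ v →
    mk⇔ (⋃⊆⋃refineAt ∘ partition-⊇ Φ-part)
        (λ v∈⋃Q → let a , v∈Φa = ⋃refineAt⊆⋃ v∈⋃Q in partition-⊆ Φ-part a v∈Φa)

  crosses-disjoint : ∀ {E} → Crosses E Φ → Crosses E T → ⊥
  crosses-disjoint (_ , meets-two-Φ) (E⊆⋃T , _) =
    ¬meetsTwo-⊆block Φ-disjoint E⊆Φi meets-two-Φ
    where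
    E⊆Φi : _ ⊆ Φ i
    E⊆Φi v∈E = let t , v∈Tt = E⊆⋃T _ v∈E in T⊆Φi t v∈Tt

  crosses-refineAt⁺ : ∀ {E} → Crosses E Φ ⊎ Crosses E T → Crosses E Q
  crosses-refineAt⁺ (inj₁ (E⊆⋃Φ , two)) =
    (λ v v∈E → ⋃⊆⋃refineAt (E⊆⋃Φ v v∈E)) ,
    meetsTwo-refinement Φ-disjoint refineAt-refines ⋃⊆⋃refineAt two
  crosses-refineAt⁺ (inj₂ (E⊆⋃T , two)) =
    (λ v v∈E → let t , v∈Tt = E⊆⋃T v v∈E in t ↑ˡ p , ⊆inner t v∈Tt) ,
    meetsTwo-subfamily (_↑ˡ p) (↑ˡ-injective p _ _) ⊆inner two

  -- An edge meeting two blocks of T either lies inside ⋃T = Φ i, or has a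
  -- vertex in some other block of Φ.
  private
    meetsTwo-inner : ∀ {E t₁ t₂} → E ⊆⋃ Q → t₁ ≢ t₂ → Meets E (T t₁) → Meets E (T t₂) →
      MeetsTwo E Φ ⊎ Crosses E T
    meetsTwo-inner {E} {t₁} {t₂} E⊆⋃Q t₁≢t₂ m₁ m₂ with ⊆⋃-or-escapes E T
    ... | inj₁ E⊆⋃T = inj₂ (E⊆⋃T , t₁ , t₂ , t₁≢t₂ , m₁ , m₂)
    ... | inj₂ (v , v∈E , v∉⋃T) with ⋃refineAt⊆⋃ (E⊆⋃Q v v∈E) | meets⁻ m₁
    ...   | a , v∈Φa | u , u∈E , u∈Tt₁ = inj₁ (meetsTwo⁺ u∈E v∈E (T⊆Φi t₁ u∈Tt₁) v∈Φa i≢a)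
      where
      i≢a : i ≢ a
      i≢a ≡.refl = v∉⋃T (partition-⊇ T-part v∈Φa)

  meetsTwo-refineAt⁻ : ∀ {E} → E ⊆⋃ Q → MeetsTwo E Q → MeetsTwo E Φ ⊎ Crosses E T
  meetsTwo-refineAt⁻ E⊆⋃Q (j₁ , j₂ , j₁≢j₂ , m₁ , m₂) with splitView q j₁ | splitView q j₂
  ... | inner t₁ | inner t₂ = meetsTwo-inner E⊆⋃Q (j₁≢j₂ ∘ ≡.cong (_↑ˡ p))
        (meets-mono (inner⊆ t₁) m₁) (meets-mono (inner⊆ t₂) m₂)
  ... | inner t | outer b = inj₁ (i , punchIn i b , i≢punchIn b ,
        meets-mono (T⊆Φi t ∘ inner⊆ t) m₁ , meets-mono (outer⊆ b) m₂)
  ... | outer b | inner t = inj₁ (punchIn i b , i , i≢punchIn b ∘ ≡.sym ,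
        meets-mono (outer⊆ b) m₁ , meets-mono (T⊆Φi t ∘ inner⊆ t) m₂)
  ... | outer b₁ | outer b₂ = inj₁ (punchIn i b₁ , punchIn i b₂ ,
        j₁≢j₂ ∘ ≡.cong (q ↑ʳ_) ∘ punchIn-injective i b₁ b₂ ,
        meets-mono (outer⊆ b₁) m₁ , meets-mono (outer⊆ b₂) m₂)

  crosses-refineAt⁻ : ∀ {E} → Crosses E Q → Crosses E Φ ⊎ Crosses E T
  crosses-refineAt⁻ (E⊆⋃Q , two) with meetsTwo-refineAt⁻ E⊆⋃Q two
  ... | inj₁ two-Φ = inj₁ ((λ v v∈E → ⋃refineAt⊆⋃ (E⊆⋃Q v v∈E)) , two-Φ)
  ... | inj₂ crosses-T = inj₂ crosses-T

  crosses-refineAt : ∀ {E} → Crosses E Q ⇔ (Crosses E Φ ⊎ Crosses E T)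
  crosses-refineAt = mk⇔ crosses-refineAt⁻ crosses-refineAt⁺

edgeAt : ∀ {m} → Hypergraph n m → Fin m → Hypergraph n 1
edgeAt H e = record
  { edge     = λ _ → Hypergraph.edge H e
  ; nonempty = λ _ → Hypergraph.nonempty H e
  }

module _ {c ℓ₁ ℓ₂} (R : OrderedCommutativeRing c ℓ₁ ℓ₂) where
  open OrderedCommutativeRing R hiding (zero)
  open import Algebra.Properties.Monoid.Sum +-monoid using (sum; sum-cong-≋)
  open import Algebra.Properties.CommutativeMonoid.Sum +-commutativeMonoid using (∑-distrib-+)
  open import Algebra.Properties.Monoid.Mult +-monoid using (×-homo-+)
  open import Algebra.Definitions.RawMonoid +-rawMonoid using () renaming (_×_ to _·ℕ_)
  open import Algebra.Properties.AbelianGroup +-abelianGroup using (xyx⁻¹≈y; ⁻¹-∙-comm)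
  open import Algebra.Properties.CommutativeSemigroup +-commutativeSemigroup using (interchange)
  open import Relation.Binary.Reasoning.Setoid setoid
  open IsTotalOrder isTotalOrder using (≤-respˡ-≈; ≤-respʳ-≈)

  -- The summand of xδ is local to its definition; on one-edge hypergraphs it
  -- is exposed to 'with inδ? H P zero', which is how xδ-additive₁ computes.
  xδ-edgewise : ∀ {m} (H : Hypergraph n m) (x : Fin m → Carrier) (P : Family n k) →
    xδ R H x P ≈ sum (λ e → xδ R (edgeAt H e) (λ _ → x e) P)
  xδ-edgewise {m = m} H x P = sum-cong-≋ {m} λ _ → sym (+-identityʳ _)

  x+[0+0]≈x : ∀ y → y + (0# + 0#) ≈ y
  x+[0+0]≈x y = trans (+-congˡ (+-identityʳ 0#)) (+-identityʳ y)

  [0+0]+x≈x : ∀ y → (0# + 0#) + y ≈ y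
  [0+0]+x≈x y = trans (+-congʳ (+-identityʳ 0#)) (+-identityˡ y)

  xδ-additive₁ : ∀ {k₁ k₂} (H : Hypergraph n 1) (x : Fin 1 → Carrier)
    (P : Family n k) (P₁ : Family n k₁) (P₂ : Family n k₂) →
    (Inδ H P₁ zero → Inδ H P₂ zero → ⊥) → (Inδ H P zero ⇔ (Inδ H P₁ zero ⊎ Inδ H P₂ zero)) →
    xδ R H x P ≈ xδ R H x P₁ + xδ R H x P₂
  xδ-additive₁ H x P P₁ P₂ exclusive split
    with inδ? H P zero | inδ? H P₁ zero | inδ? H P₂ zero
  ... | _      | yes h₁  | yes h₂  = ⊥-elim (exclusive h₁ h₂)
  ... | yes _  | yes _   | no _    = sym (x+[0+0]≈x _)
  ... | yes _  | no _    | yes _   = sym ([0+0]+x≈x _)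
  ... | no _   | no _    | no _    = sym (x+[0+0]≈x _)
  ... | yes h  | no ¬h₁  | no ¬h₂  = ⊥-elim ([ ¬h₁ , ¬h₂ ]′ (Equivalence.to split h))
  ... | no ¬h  | yes h₁  | no _    = ⊥-elim (¬h (Equivalence.from split (inj₁ h₁)))
  ... | no ¬h  | no _    | yes h₂  = ⊥-elim (¬h (Equivalence.from split (inj₂ h₂)))

  xδ-additive : ∀ {m k₁ k₂} (H : Hypergraph n m) (x : Fin m → Carrier)
    (P : Family n k) (P₁ : Family n k₁) (P₂ : Family n k₂) →
    (∀ e → Inδ H P₁ e → Inδ H P₂ e → ⊥) → (∀ e → Inδ H P e ⇔ (Inδ H P₁ e ⊎ Inδ H P₂ e)) →
    xδ R H x P ≈ xδ R H x P₁ + xδ R H x P₂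
  xδ-additive {n = n} {m = m} H x P P₁ P₂ exclusive split = begin
    xδ R H x P                                        ≈⟨ xδ-edgewise H x P ⟩
    sum (λ e → xδ₁ e P)                               ≈⟨ sum-cong-≋ {m} (λ e →
      xδ-additive₁ (edgeAt H e) (λ _ → x e) P P₁ P₂ (exclusive e) (split e)) ⟩
    sum (λ e → xδ₁ e P₁ + xδ₁ e P₂)                   ≈⟨ ∑-distrib-+ (λ e → xδ₁ e P₁) (λ e → xδ₁ e P₂) ⟩
    sum (λ e → xδ₁ e P₁) + sum (λ e → xδ₁ e P₂)       ≈⟨ +-cong (xδ-edgewise H x P₁) (xδ-edgewise H x P₂) ⟨
    xδ R H x P₁ + xδ R H x P₂                         ∎
    where
    xδ₁ : ∀ {k} → Fin m → Family n k → Carrier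
    xδ₁ e = xδ R (edgeAt H e) (λ _ → x e)

  penalty : ℕ → Carrier → Carrier
  penalty k β = k ·ℕ β - β

  penalty-+ : ∀ p q β → penalty (q ℕ.+ p) β ≈ penalty (suc p) β + penalty q β
  penalty-+ p q β = begin
    (q ℕ.+ p) ·ℕ β - β                 ≈⟨ +-congʳ (×-homo-+ β q p) ⟩
    (q ·ℕ β + p ·ℕ β) - β              ≈⟨ +-congʳ (+-comm _ _) ⟩
    (p ·ℕ β + q ·ℕ β) - β              ≈⟨ +-assoc _ _ _ ⟩
    p ·ℕ β + (q ·ℕ β - β)              ≈⟨ +-congʳ (xyx⁻¹≈y β (p ·ℕ β)) ⟨
    (β + p ·ℕ β) - β + (q ·ℕ β - β)    ∎

  -‿interchange : ∀ a b c d → (a + b) - (c + d) ≈ (a - c) + (b - d)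
  -‿interchange a b c d = trans (+-congˡ (sym (⁻¹-∙-comm c d))) (interchange a b (- c) (- d))

  objective-additive : ∀ {m p q} (H : Hypergraph n m) (x : Fin m → Carrier) (β : Carrier)
    (Q : Family n (q ℕ.+ p)) (Φ : Family n (suc p)) (T : Family n q) →
    xδ R H x Q ≈ xδ R H x Φ + xδ R H x T →
    objective R H x β Q ≈ objective R H x β Φ + objective R H x β T
  objective-additive {p = p} {q} H x β Q Φ T xδ-split =
    trans (+-cong xδ-split (-‿cong (penalty-+ p q β)))
          (-‿interchange (xδ R H x Φ) (xδ R H x T) (penalty (suc p) β) (penalty q β))

  x≤x+y⇒0≤y : ∀ {a t} → a ≤ a + t → 0# ≤ t
  x≤x+y⇒0≤y {a} {t} a≤a+t =
    ≤-respˡ-≈ (-‿inverseʳ a) (≤-respʳ-≈ (xyx⁻¹≈y a t) (+-mono-≤ (- a) a≤a+t))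

lemma1 : ∀ {c ℓ₁ ℓ₂ : Level} (R : OrderedCommutativeRing c ℓ₁ ℓ₂) →
    let open OrderedCommutativeRing R in
    ∀ {n m : ℕ} (H : Hypergraph n m) (x : Fin m → Carrier) → (∀ e → 0# ≤ x e) →
    ∀ (β : Carrier) {p : ℕ} (Φ : Family n p) → IsPartitionOf Φ ⊤ →
    (∀ {k : ℕ} (Q : Family n k) → IsPartitionOf Q ⊤ →
      objective R H x β Φ ≤ objective R H x β Q) →
    ∀ (i : Fin p) {q : ℕ} (T : Family n q) → IsPartitionOf T (Φ i) →
    0# ≤ objective R H x β T
lemma1 R H x _ β {suc _} Φ Φ-part Φ-minimal i T T-part =
  x≤x+y⇒0≤y R (≤-respʳ-≈ objective-split (Φ-minimal Q refineAt-partition))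
  where
  open OrderedCommutativeRing R using (_≈_; _+_; isTotalOrder)
  open IsTotalOrder isTotalOrder using (≤-respʳ-≈)
  open Refinement Φ-part T-part
  objective-split : objective R H x β Q ≈ objective R H x β Φ + objective R H x β T
  objective-split = objective-additive R H x β Q Φ T
    (xδ-additive R H x Q Φ T (λ _ → crosses-disjoint) (λ _ → crosses-refineAt))
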